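{- For every positive integer $k$, the class $\mathcal{CW}_k$ of finite matroids of cyclic width at most $k$ is closed under free extension, free coextension, truncation, and the Higgs lift.
   Context: A flat is cyclic if it is a (possibly empty) union of circuits; the cyclic width of $M$ is the maximum size of an antichain in the poset (under inclusion) of cyclic flats of $M$. The free extension $M+e$ ($e\notin E(M)$) is the matroid on $E(M)\cup e$ whose circuits are those of $M$ together with the sets $B\cup e$ for bases $B$ of $M$; the free coextension is $(M^*+e)^*$. The truncation of $M$ is $(M+e)/e$, the matroid on $E(M)$ whose bases are the independent sets of $M$ of size $r(M)-1$; the Higgs lift is the dual operation $M\mapsto (T(M^*))^*$ where $T$ is truncation. -}

module Defs where

open import Data.Bool using (Bool; true; false; _∧_; _∨_; not; if_then_else_)
open import Data.Nat using (ℕ; zero; suc; _+_; _∸_; _≤_; _<_; _⊔_; _≡ᵇ_)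
open import Data.Fin using (Fin)
open import Data.Vec using (_∷_; [])
open import Data.List using (List; []; _∷_; _++_; map; foldr; length)
open import Data.Bool.ListAction using (any; all)
open import Data.List.Relation.Unary.All using (All)
open import Data.List.Relation.Unary.AllPairs using (AllPairs)
open import Data.Fin.Subset using (Subset; _⊆_; _∈_; _∉_; _∪_; ∁; ⁅_⁆; ∣_∣; ⊥; ⊤)
open import Data.Fin.Subset.Properties using (_⊆?_)
open import Data.Product using (Σ; ∃; _×_)
open import Relation.Nullary using (¬_)
open import Relation.Nullary.Decidable using (⌊_⌋)
open import Relation.Binary.PropositionalEquality using (_≡_)

Indep : ℕ → Set
Indep n = Subset n → Bool

record IsMatroid {n : ℕ} (ind : Indep n) : Set where
  field
    empty-indep : ind ⊥ ≡ true
    down-closed : ∀ {X Y : Subset n} → X ⊆ Y → ind Y ≡ true → ind X ≡ true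
    augment     : ∀ {X Y : Subset n} → ind X ≡ true → ind Y ≡ true →
                  ∣ X ∣ < ∣ Y ∣ →
                  ∃ λ (e : Fin n) → e ∈ Y × e ∉ X × ind (X ∪ ⁅ e ⁆) ≡ true

_⊆ᵇ_ : ∀ {n} → Subset n → Subset n → Bool
X ⊆ᵇ Y = ⌊ X ⊆? Y ⌋

allSubsets : (n : ℕ) → List (Subset n)
allSubsets zero    = [] ∷ []
allSubsets (suc n) = map (false ∷_) (allSubsets n) ++ map (true ∷_) (allSubsets n)

existsS : ∀ {n} → (Subset n → Bool) → Bool
existsS {n} p = any p (allSubsets n)

forallS : ∀ {n} → (Subset n → Bool) → Bool
forallS {n} p = all p (allSubsets n)

rank : ∀ {n} → Indep n → Subset n → ℕ
rank {n} ind X =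
  foldr (λ Y acc → if (Y ⊆ᵇ X) ∧ ind Y then ∣ Y ∣ ⊔ acc else acc) 0 (allSubsets n)

isBasis : ∀ {n} → Indep n → Subset n → Bool
isBasis ind B = ind B ∧ forallS (λ X → not ((B ⊆ᵇ X) ∧ ind X) ∨ (X ⊆ᵇ B))

isCircuit : ∀ {n} → Indep n → Subset n → Bool
isCircuit ind C = not (ind C) ∧ forallS (λ D → not (D ⊆ᵇ C) ∨ (C ⊆ᵇ D) ∨ ind D)

dual : ∀ {n} → Indep n → Indep n
dual ind X = existsS (λ B → isBasis ind B ∧ (X ⊆ᵇ ∁ B))

-- free extension M + e on Fin (suc n); the new element e is index zero
-- (the head of the vector).
isCircuitFreeExt : ∀ {n} → Indep n → Subset (suc n) → Bool
isCircuitFreeExt ind (false ∷ C) = isCircuit ind C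
isCircuitFreeExt ind (true  ∷ B) = isBasis ind B

freeExt : ∀ {n} → Indep n → Indep (suc n)
freeExt ind I = not (existsS (λ C → (C ⊆ᵇ I) ∧ isCircuitFreeExt ind C))

freeCoext : ∀ {n} → Indep n → Indep (suc n)
freeCoext ind = dual (freeExt (dual ind))

contract0 : ∀ {n} → Indep (suc n) → Indep n
contract0 ind I = (rank ind (true ∷ I) ∸ rank ind (true ∷ ⊥)) ≡ᵇ ∣ I ∣

truncation : ∀ {n} → Indep n → Indep n
truncation ind = contract0 (freeExt ind)

higgsLift : ∀ {n} → Indep n → Indep n
higgsLift ind = dual (truncation (dual ind))

IsFlat : ∀ {n} → Indep n → Subset n → Set
IsFlat ind F = ∀ e → rank ind (F ∪ ⁅ e ⁆) ≡ rank ind F → e ∈ F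

IsUnionOfCircuits : ∀ {n} → Indep n → Subset n → Set
IsUnionOfCircuits ind F =
  ∀ e → e ∈ F → ∃ λ C → isCircuit ind C ≡ true × e ∈ C × C ⊆ F

IsCyclicFlat : ∀ {n} → Indep n → Subset n → Set
IsCyclicFlat ind F = IsFlat ind F × IsUnionOfCircuits ind F

Incomparable : ∀ {n} → Subset n → Subset n → Set
Incomparable X Y = ¬ (X ⊆ Y) × ¬ (Y ⊆ X)

-- cyclic width ≤ k : every antichain (list of pairwise incomparable, hence
-- distinct, sets) of cyclic flats has at most k elements
CyclicWidth≤ : ∀ {n} → ℕ → Indep n → Set
CyclicWidth≤ k ind =
  ∀ (A : List (Subset _)) → All (IsCyclicFlat ind) A → AllPairs Incomparable A →
  length A ≤ k

InCW : ℕ → ∀ {n} → Indep n → Set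
InCW k ind = IsMatroid ind × CyclicWidth≤ k ind

{-# OPTIONS --safe #-}
module Submission where

-- The argument runs through rank functions. A matroid is determined by its rank function r,
-- and F is a cyclic flat iff adding an element outside F raises r while deleting an element
-- of F does not. The operations have explicit rank functions: |X| + r(E − X) − r(E) for the
-- dual, min(r, r(E) − 1) for the truncation, and min(r(X − e) + [e ∈ X], r(E)) for the free
-- extension. Reading off these formulas, every cyclic flat of the new matroid other than its
-- ground set is a cyclic flat of M, or for the dual the complement of one, and these maps
-- reflect incomparability. So an antichain of cyclic flats either contains the ground set,
-- and then has a single member, or comes from an antichain of M of the same length. The free
-- coextension and the Higgs lift are duals of the free extension and the truncation.

open import Defs
open import Data.Nat using (ℕ; _≤_)
open import Data.Product using (_×_)

import Algebra.Lattice.Properties.BooleanAlgebra as BooleanAlgebra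
open import Data.Bool using (Bool; true; false; not; _∧_; _∨_; if_then_else_)
open import Data.Bool.Properties using (T-≡; T-not-≡; ∧-conicalˡ; ∧-conicalʳ; ¬-not; not-¬; not-injective)
import Data.Bool.Properties as Bool
open import Data.Empty using (⊥-elim)
open import Data.Fin using (Fin; zero; suc) renaming (_≟_ to _≟ᶠ_)
open import Data.Fin.Properties using (any?)
open import Data.Fin.Subset
open import Data.Fin.Subset.Properties
open import Data.List using (List; []; _∷_; map; length; foldr)
open import Data.List.Membership.Propositional using (lose) renaming (_∈_ to _∈ₗ_)
open import Data.List.Membership.Propositional.Properties using (∈-++⁺ˡ; ∈-++⁺ʳ; ∈-map⁺)
open import Data.List.Properties using (length-map)
import Data.List.Relation.Unary.All as All
open import Data.List.Relation.Unary.All using (All; []; _∷_)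
open import Data.List.Relation.Unary.All.Properties using (all⁺; all⁻; ¬Any⇒All¬)
import Data.List.Relation.Unary.AllPairs as AllPairs
open import Data.List.Relation.Unary.AllPairs using (AllPairs; []; _∷_)
import Data.List.Relation.Unary.AllPairs.Properties as AllPairs
import Data.List.Relation.Unary.Any as Any
open import Data.List.Relation.Unary.Any using (here; there; satisfied)
open import Data.List.Relation.Unary.Any.Properties using (any⁺; any⁻)
open import Data.Nat using (zero; suc; _+_; _∸_; _<_; _⊓_; _⊔_; s≤s)
open import Data.Nat.Properties
open import Algebra.Properties.CommutativeSemigroup +-commutativeSemigroup using (interchange)
open import Data.Product using (∃; _,_; proj₁; proj₂)
open import Data.Sum using (_⊎_; inj₁; inj₂; [_,_]′)
import Data.Sum
open import Data.Vec using (_∷_; []; here; there)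
open import Data.Vec.Properties using (≡-dec)
open import Function using (_∘_; case_of_; Equivalence)
open import Relation.Nullary using (¬_; yes; no; _×-dec_; ¬?; contradiction)
open import Relation.Nullary.Decidable using (toWitness; fromWitness; fromWitnessFalse)
open import Relation.Binary.PropositionalEquality

private
  variable
    n : ℕ

x∉p⇒∣p∪⁅x⁆∣≡1+∣p∣ : ∀ {x : Fin n} {p} → x ∉ p → ∣ p ∪ ⁅ x ⁆ ∣ ≡ suc ∣ p ∣
x∉p⇒∣p∪⁅x⁆∣≡1+∣p∣ {x = zero}  {false ∷ p} _   = cong suc (cong ∣_∣ (∪-identityʳ p))
x∉p⇒∣p∪⁅x⁆∣≡1+∣p∣ {x = zero}  {true  ∷ p} x∉p = contradiction here x∉p
x∉p⇒∣p∪⁅x⁆∣≡1+∣p∣ {x = suc x} {false ∷ p} x∉p = x∉p⇒∣p∪⁅x⁆∣≡1+∣p∣ (x∉p ∘ there)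
x∉p⇒∣p∪⁅x⁆∣≡1+∣p∣ {x = suc x} {true  ∷ p} x∉p = cong suc (x∉p⇒∣p∪⁅x⁆∣≡1+∣p∣ (x∉p ∘ there))

∣p∪q∣+∣p∩q∣≡∣p∣+∣q∣ : (p q : Subset n) → ∣ p ∪ q ∣ + ∣ p ∩ q ∣ ≡ ∣ p ∣ + ∣ q ∣
∣p∪q∣+∣p∩q∣≡∣p∣+∣q∣ []          []          = refl
∣p∪q∣+∣p∩q∣≡∣p∣+∣q∣ (false ∷ p) (false ∷ q) = ∣p∪q∣+∣p∩q∣≡∣p∣+∣q∣ p q
∣p∪q∣+∣p∩q∣≡∣p∣+∣q∣ (false ∷ p) (true  ∷ q) =
  trans (cong suc (∣p∪q∣+∣p∩q∣≡∣p∣+∣q∣ p q)) (sym (+-suc ∣ p ∣ ∣ q ∣))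
∣p∪q∣+∣p∩q∣≡∣p∣+∣q∣ (true  ∷ p) (false ∷ q) = cong suc (∣p∪q∣+∣p∩q∣≡∣p∣+∣q∣ p q)
∣p∪q∣+∣p∩q∣≡∣p∣+∣q∣ (true  ∷ p) (true  ∷ q) = cong suc (begin
  ∣ p ∪ q ∣ + suc ∣ p ∩ q ∣ ≡⟨ +-suc _ _ ⟩
  suc (∣ p ∪ q ∣ + ∣ p ∩ q ∣) ≡⟨ cong suc (∣p∪q∣+∣p∩q∣≡∣p∣+∣q∣ p q) ⟩
  suc (∣ p ∣ + ∣ q ∣) ≡⟨ +-suc ∣ p ∣ ∣ q ∣ ⟨
  ∣ p ∣ + suc ∣ q ∣ ∎)
  where open ≡-Reasoning

p⊆q⇒∣q∣≡∣p∣+∣q─p∣ : ∀ {p q : Subset n} → p ⊆ q → ∣ q ∣ ≡ ∣ p ∣ + ∣ q ─ p ∣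
p⊆q⇒∣q∣≡∣p∣+∣q─p∣ {p = []}        {[]}        _   = refl
p⊆q⇒∣q∣≡∣p∣+∣q─p∣ {p = false ∷ p} {false ∷ q} p⊆q = p⊆q⇒∣q∣≡∣p∣+∣q─p∣ (drop-∷-⊆ p⊆q)
p⊆q⇒∣q∣≡∣p∣+∣q─p∣ {p = false ∷ p} {true  ∷ q} p⊆q =
  trans (cong suc (p⊆q⇒∣q∣≡∣p∣+∣q─p∣ (drop-∷-⊆ p⊆q))) (sym (+-suc ∣ p ∣ _))
p⊆q⇒∣q∣≡∣p∣+∣q─p∣ {p = true  ∷ p} {false ∷ q} p⊆q with () ← p⊆q here
p⊆q⇒∣q∣≡∣p∣+∣q─p∣ {p = true  ∷ p} {true  ∷ q} p⊆q = cong suc (p⊆q⇒∣q∣≡∣p∣+∣q─p∣ (drop-∷-⊆ p⊆q))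

p⊆q⇒∣q∣≤∣p∣⇒p≡q : ∀ {p q : Subset n} → p ⊆ q → ∣ q ∣ ≤ ∣ p ∣ → p ≡ q
p⊆q⇒∣q∣≤∣p∣⇒p≡q {p = p} {q} p⊆q ∣q∣≤∣p∣ =
  ⊆-antisym p⊆q (λ {x} x∈q → case-∈ x x∈q)
  where
  case-∈ : ∀ x → x ∈ q → x ∈ p
  case-∈ x x∈q with x ∈? p
  ... | yes x∈p = x∈p
  ... | no  x∉p = contradiction ∣q∣≤∣p∣ (<⇒≱ (p⊂q⇒∣p∣<∣q∣ (p⊆q , x , x∈q , x∉p)))

q⊆p∪q─p : (p q : Subset n) → q ⊆ p ∪ (q ─ p)
q⊆p∪q─p p q {x} x∈q with x ∈? p
... | yes x∈p = x∈p∪q⁺ (inj₁ x∈p)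
... | no  x∉p = x∈p∪q⁺ (inj₂ (x∈p∧x∉q⇒x∈p─q x∈q x∉p))

∪-least : ∀ {p q r : Subset n} → p ⊆ r → q ⊆ r → p ∪ q ⊆ r
∪-least {p = p} {q} p⊆r q⊆r x∈p∪q with x∈p∪q⁻ p q x∈p∪q
... | inj₁ x∈p = p⊆r x∈p
... | inj₂ x∈q = q⊆r x∈q

x∈p⇒⁅x⁆⊆p : ∀ {x : Fin n} {p} → x ∈ p → ⁅ x ⁆ ⊆ p
x∈p⇒⁅x⁆⊆p {x = x} x∈p y∈⁅x⁆ rewrite x∈⁅y⁆⇒x≡y x y∈⁅x⁆ = x∈p

x∈p⇒p∪⁅x⁆≡p : ∀ {x : Fin n} {p} → x ∈ p → p ∪ ⁅ x ⁆ ≡ p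
x∈p⇒p∪⁅x⁆≡p x∈p = ⊆-antisym (∪-least ⊆-refl (x∈p⇒⁅x⁆⊆p x∈p)) (p⊆p∪q _)

p⊆∁q⇒q⊆∁p : ∀ {p q : Subset n} → p ⊆ ∁ q → q ⊆ ∁ p
p⊆∁q⇒q⊆∁p p⊆∁q x∈q = x∉p⇒x∈∁p (λ x∈p → x∈p⇒x∉∁p x∈q (p⊆∁q x∈p))

x∈p─q⇒x∉q : ∀ {x : Fin n} (p q : Subset n) → x ∈ p ─ q → x ∉ q
x∈p─q⇒x∉q (_ ∷ p) (false ∷ q) (there x∈p─q) (there x∈q) = x∈p─q⇒x∉q p q x∈p─q x∈q
x∈p─q⇒x∉q (_ ∷ p) (true  ∷ q) (there x∈p─q) (there x∈q) = x∈p─q⇒x∉q p q x∈p─q x∈q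

x∉p-x : ∀ (x : Fin n) p → x ∉ p - x
x∉p-x x p x∈p-x = x∈p─q⇒x∉q p ⁅ x ⁆ x∈p-x (x∈⁅x⁆ x)

p-x⊆p : ∀ (x : Fin n) p → p - x ⊆ p
p-x⊆p x p = p─q⊆p p ⁅ x ⁆

x∈p⇒p-x∪⁅x⁆≡p : ∀ {x : Fin n} {p} → x ∈ p → (p - x) ∪ ⁅ x ⁆ ≡ p
x∈p⇒p-x∪⁅x⁆≡p {x = x} {p} x∈p = ⊆-antisym (∪-least (p-x⊆p x p) (x∈p⇒⁅x⁆⊆p x∈p)) split
  where
  split : p ⊆ (p - x) ∪ ⁅ x ⁆
  split {y} y∈p with y ≟ᶠ x
  ... | yes refl = x∈p∪q⁺ (inj₂ (x∈⁅x⁆ x))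
  ... | no  y≢x  = x∈p∪q⁺ (inj₁ (x∈p∧x≢y⇒x∈p-y y∈p y≢x))

x∈p⇒∣p∣≡1+∣p-x∣ : ∀ {x : Fin n} {p} → x ∈ p → ∣ p ∣ ≡ suc ∣ p - x ∣
x∈p⇒∣p∣≡1+∣p-x∣ {x = x} {p} x∈p =
  trans (cong ∣_∣ (sym (x∈p⇒p-x∪⁅x⁆≡p x∈p))) (x∉p⇒∣p∪⁅x⁆∣≡1+∣p∣ (x∉p-x x p))

∁[p∪⁅x⁆]≡∁p-x : ∀ (p : Subset n) x → ∁ (p ∪ ⁅ x ⁆) ≡ ∁ p - x
∁[p∪⁅x⁆]≡∁p-x p x = ⊆-antisym to from
  where
  to : ∁ (p ∪ ⁅ x ⁆) ⊆ ∁ p - x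
  to y∈∁ = x∈p∧x≢y⇒x∈p-y (x∉p⇒x∈∁p (x∈∁p⇒x∉p y∈∁ ∘ x∈p∪q⁺ ∘ inj₁))
                          (λ { refl → x∈∁p⇒x∉p y∈∁ (x∈p∪q⁺ (inj₂ (x∈⁅x⁆ x))) })
  from : ∁ p - x ⊆ ∁ (p ∪ ⁅ x ⁆)
  from {y} y∈∁p-x = x∉p⇒x∈∁p λ y∈p∪⁅x⁆ → [ x∈∁p⇒x∉p (p-x⊆p x (∁ p) y∈∁p-x)
                                          , x∈p─q⇒x∉q (∁ p) ⁅ x ⁆ y∈∁p-x ]′ (x∈p∪q⁻ p ⁅ x ⁆ y∈p∪⁅x⁆)

p⊆q⇒p-x⊆q-x : ∀ {p q : Subset n} x → p ⊆ q → p - x ⊆ q - x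
p⊆q⇒p-x⊆q-x {p = p} x p⊆q y∈p-x =
  x∈p∧x≢y⇒x∈p-y (p⊆q (p-x⊆p x p y∈p-x)) (x∉⁅y⁆⇒x≢y (x∈p─q⇒x∉q p ⁅ x ⁆ y∈p-x))

∁-involutive : (p : Subset n) → ∁ (∁ p) ≡ p
∁-involutive {n} = BooleanAlgebra.¬-involutive (∪-∩-booleanAlgebra n)

∁[p-x]≡∁p∪⁅x⁆ : ∀ (p : Subset n) x → ∁ (p - x) ≡ ∁ p ∪ ⁅ x ⁆
∁[p-x]≡∁p∪⁅x⁆ p x = begin
  ∁ (p - x)           ≡⟨ cong (λ q → ∁ (q - x)) (∁-involutive p) ⟨
  ∁ (∁ (∁ p) - x)     ≡⟨ cong ∁ (∁[p∪⁅x⁆]≡∁p-x (∁ p) x) ⟨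
  ∁ (∁ (∁ p ∪ ⁅ x ⁆)) ≡⟨ ∁-involutive _ ⟩
  ∁ p ∪ ⁅ x ⁆         ∎
  where open ≡-Reasoning

⊈⇒∃ : ∀ {p q : Subset n} → ¬ p ⊆ q → ∃ λ x → x ∈ p × x ∉ q
⊈⇒∃ {p = p} {q} p⊈q with any? (λ x → x ∈? p ×-dec ¬? (x ∈? q))
... | yes witness = witness
... | no  none    = contradiction (λ {x} → included) p⊈q
  where
  included : p ⊆ q
  included {x} x∈p with x ∈? q
  ... | yes x∈q = x∈q
  ... | no  x∉q = contradiction (x , x∈p , x∉q) none

∈-allSubsets : (X : Subset n) → X ∈ₗ allSubsets n
∈-allSubsets []                    = here refl
∈-allSubsets {suc n} (false ∷ X) = ∈-++⁺ˡ (∈-map⁺ (false ∷_) (∈-allSubsets X))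
∈-allSubsets {suc n} (true  ∷ X) =
  ∈-++⁺ʳ (map (false ∷_) (allSubsets n)) (∈-map⁺ (true ∷_) (∈-allSubsets X))

module _ (p : Subset n → Bool) where

  existsS⇒∃ : existsS p ≡ true → ∃ λ X → p X ≡ true
  existsS⇒∃ ∃p = let X , pX = satisfied (any⁻ p (allSubsets n) (Equivalence.from T-≡ ∃p))
                 in X , Equivalence.to T-≡ pX

  ∃⇒existsS : ∀ {X} → p X ≡ true → existsS p ≡ true
  ∃⇒existsS {X} pX = Equivalence.to T-≡ (any⁺ p (lose (∈-allSubsets X) (Equivalence.from T-≡ pX)))

  forallS⇒∀ : forallS p ≡ true → ∀ X → p X ≡ true
  forallS⇒∀ ∀p X = Equivalence.to T-≡ (All.lookup (all⁺ p _ (Equivalence.from T-≡ ∀p)) (∈-allSubsets X))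

  ∀⇒forallS : (∀ X → p X ≡ true) → forallS p ≡ true
  ∀⇒forallS ∀p =
    Equivalence.to T-≡ (all⁻ p {allSubsets n} (All.tabulate λ {X} _ → Equivalence.from T-≡ (∀p X)))

⊆ᵇ⇒⊆ : ∀ {X Y : Subset n} → X ⊆ᵇ Y ≡ true → X ⊆ Y
⊆ᵇ⇒⊆ X⊆ᵇY = toWitness (Equivalence.from T-≡ X⊆ᵇY)

⊆⇒⊆ᵇ : ∀ {X Y : Subset n} → X ⊆ Y → X ⊆ᵇ Y ≡ true
⊆⇒⊆ᵇ X⊆Y = Equivalence.to T-≡ (fromWitness (λ {x} → X⊆Y))

⊈⇒⊆ᵇ : ∀ {X Y : Subset n} → ¬ X ⊆ Y → X ⊆ᵇ Y ≡ false
⊈⇒⊆ᵇ X⊈Y = Equivalence.to T-not-≡ (fromWitnessFalse {a? = _ ⊆? _} X⊈Y)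

-- rank ind X unfolds to maxSelected ∣_∣ (λ Y → (Y ⊆ᵇ X) ∧ ind Y) (allSubsets n).
module _ {A : Set} (weight : A → ℕ) (selected : A → Bool) where

  maxSelected : List A → ℕ
  maxSelected = foldr (λ a m → if selected a then weight a ⊔ m else m) 0

  maxSelected-upper : ∀ {a} L → a ∈ₗ L → selected a ≡ true → weight a ≤ maxSelected L
  maxSelected-upper (b ∷ L) (here refl) b-sel rewrite b-sel = m≤m⊔n _ _
  maxSelected-upper (b ∷ L) (there a∈L) a-sel with selected b
  ... | true  = ≤-trans (maxSelected-upper L a∈L a-sel) (m≤n⊔m _ _)
  ... | false = maxSelected-upper L a∈L a-sel

  maxSelected-attained : ∀ L → maxSelected L ≡ 0 ⊎ ∃ λ a → selected a ≡ true × weight a ≡ maxSelected L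
  maxSelected-attained []      = inj₁ refl
  maxSelected-attained (b ∷ L) with selected b in b-sel
  ... | false = maxSelected-attained L
  ... | true with ⊔-sel (weight b) (maxSelected L)
  ...   | inj₁ max≡b = inj₂ (b , b-sel , sym max≡b)
  ...   | inj₂ max≡L rewrite max≡L = maxSelected-attained L

rank-upper : ∀ (ind : Indep n) {X Y} → Y ⊆ X → ind Y ≡ true → ∣ Y ∣ ≤ rank ind X
rank-upper {n} ind {X} {Y} Y⊆X indY =
  maxSelected-upper ∣_∣ (λ Z → (Z ⊆ᵇ X) ∧ ind Z) (allSubsets n) (∈-allSubsets Y)
    (trans (cong (_∧ ind Y) (⊆⇒⊆ᵇ Y⊆X)) indY)

rank-attained : ∀ (ind : Indep n) → ind ⊥ ≡ true →
                ∀ X → ∃ λ Y → Y ⊆ X × ind Y ≡ true × ∣ Y ∣ ≡ rank ind X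
rank-attained {n} ind ind⊥ X
  with maxSelected-attained ∣_∣ (λ Z → (Z ⊆ᵇ X) ∧ ind Z) (allSubsets n)
... | inj₁ rank≡0 = ⊥ , ⊆-min X , ind⊥ , trans (∣⊥∣≡0 n) (sym rank≡0)
... | inj₂ (Y , Y-sel , ∣Y∣≡rank) =
  Y , ⊆ᵇ⇒⊆ (∧-conicalˡ _ _ Y-sel) , ∧-conicalʳ _ _ Y-sel , ∣Y∣≡rank

IsMinimalDependent : Indep n → Subset n → Set
IsMinimalDependent ind C = ind C ≡ false × (∀ x → x ∈ C → ind (C - x) ≡ true)

isCircuit⇒minimalDependent : ∀ (ind : Indep n) {C} → isCircuit ind C ≡ true → IsMinimalDependent ind C
isCircuit⇒minimalDependent ind {C} isC = not-injective (∧-conicalˡ _ _ isC) , minimal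
  where
  minimal : ∀ x → x ∈ C → ind (C - x) ≡ true
  minimal x x∈C = subst₂ (λ a b → not a ∨ b ∨ ind (C - x) ≡ true)
    (⊆⇒⊆ᵇ (p-x⊆p x C)) (⊈⇒⊆ᵇ (λ C⊆C-x → x∉p-x x C (C⊆C-x x∈C)))
    (forallS⇒∀ _ (∧-conicalʳ _ _ isC) (C - x))

module Circuits {ind : Indep n} (down-closed : ∀ {X Y} → X ⊆ Y → ind Y ≡ true → ind X ≡ true) where

  minimalDependent⇒isCircuit : ∀ {C} → IsMinimalDependent ind C → isCircuit ind C ≡ true
  minimalDependent⇒isCircuit {C} (dep , minimal) rewrite dep = ∀⇒forallS _ allowed
    where
    allowed : ∀ D → not (D ⊆ᵇ C) ∨ (C ⊆ᵇ D) ∨ ind D ≡ true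
    allowed D with D ⊆? C | C ⊆? D
    ... | no  _   | _      = refl
    ... | yes _   | yes _  = refl
    ... | yes D⊆C | no C⊈D with ⊈⇒∃ C⊈D
    ...   | x , x∈C , x∉D =
      down-closed (λ y∈D → x∈p∧x≢y⇒x∈p-y (D⊆C y∈D) λ { refl → x∉D y∈D }) (minimal x x∈C)

  dependent⇒∃circuit : ∀ {X} → ind X ≡ false → ∃ λ C → C ⊆ X × isCircuit ind C ≡ true
  dependent⇒∃circuit {X} depX = shrink ∣ X ∣ ≤-refl depX
    where
    shrink : ∀ {Y} m → ∣ Y ∣ ≤ m → ind Y ≡ false → ∃ λ C → C ⊆ Y × isCircuit ind C ≡ true
    shrink {Y} m ∣Y∣≤m depY with any? (λ x → x ∈? Y ×-dec ind (Y - x) Bool.≟ false)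
    ... | no none =
      Y , ⊆-refl , minimalDependent⇒isCircuit (depY , λ x x∈Y → ¬-not (λ dep → none (x , x∈Y , dep)))
    ... | yes (x , x∈Y , depY-x) with m | subst (_≤ m) (x∈p⇒∣p∣≡1+∣p-x∣ x∈Y) ∣Y∣≤m
    ...   | zero  | ()
    ...   | suc m | ∣Y-x∣<m with shrink m (≤-pred ∣Y-x∣<m) depY-x
    ...     | C , C⊆Y-x , isC = C , ⊆-trans C⊆Y-x (p-x⊆p x Y) , isC

subset-ind : (P : Subset n → Set) → P ⊥ → (∀ S x → P S → P (S ∪ ⁅ x ⁆)) → ∀ S → P S
subset-ind P P⊥ step S = go ∣ S ∣ ≤-refl
  where
  go : ∀ {S} m → ∣ S ∣ ≤ m → P S
  go {S} m ∣S∣≤m with nonempty? S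
  ... | no  empty = subst P (sym (Empty-unique empty)) P⊥
  ... | yes (x , x∈S) with m | subst (_≤ m) (x∈p⇒∣p∣≡1+∣p-x∣ x∈S) ∣S∣≤m
  ...   | zero  | ()
  ...   | suc m | ∣S-x∣<m =
    subst P (x∈p⇒p-x∪⁅x⁆≡p x∈S) (step (S - x) x (go m (≤-pred ∣S-x∣<m)))

Spans : (Subset n → ℕ) → Subset n → Fin n → Set
Spans r X x = r (X ∪ ⁅ x ⁆) ≡ r X

record IsRankFunction (r : Subset n → ℕ) : Set where
  field
    ≤-card     : ∀ X → r X ≤ ∣ X ∣
    mono       : ∀ {X Y} → X ⊆ Y → r X ≤ r Y
    submodular : ∀ X Y → r (X ∪ Y) + r (X ∩ Y) ≤ r X + r Y

  r⊥≡0 : r ⊥ ≡ 0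
  r⊥≡0 = n≤0⇒n≡0 (subst (r ⊥ ≤_) (∣⊥∣≡0 n) (≤-card ⊥))

  subadditive : ∀ X Y → r (X ∪ Y) ≤ r X + r Y
  subadditive X Y = ≤-trans (m≤m+n _ _) (submodular X Y)

  ∪⁅x⁆-dichotomy : ∀ X x → r (X ∪ ⁅ x ⁆) ≡ suc (r X) ⊎ Spans r X x
  ∪⁅x⁆-dichotomy X x with r (X ∪ ⁅ x ⁆) ≟ suc (r X)
  ... | yes grows = inj₁ grows
  ... | no  stays = inj₂ (≤-antisym (m<1+n⇒m≤n (≤∧≢⇒< ≤1+rX stays)) (mono (p⊆p∪q ⁅ x ⁆)))
    where
    ≤1+rX : r (X ∪ ⁅ x ⁆) ≤ suc (r X)
    ≤1+rX = begin
      r (X ∪ ⁅ x ⁆)   ≤⟨ subadditive X ⁅ x ⁆ ⟩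
      r X + r ⁅ x ⁆   ≤⟨ +-monoʳ-≤ (r X) (≤-card ⁅ x ⁆) ⟩
      r X + ∣ ⁅ x ⁆ ∣ ≡⟨ cong (r X +_) (∣⁅x⁆∣≡1 x) ⟩
      r X + 1         ≡⟨ +-comm (r X) 1 ⟩
      suc (r X)       ∎
      where open ≤-Reasoning

  spans-mono : ∀ {X Y} x → Y ⊆ X → Spans r Y x → Spans r X x
  spans-mono {X} {Y} x Y⊆X Y-spans = ≤-antisym (+-cancelʳ-≤ (r Y) _ _ bound) (mono (p⊆p∪q ⁅ x ⁆))
    where
    Y+x : Subset n
    Y+x = Y ∪ ⁅ x ⁆
    bound : r (X ∪ ⁅ x ⁆) + r Y ≤ r X + r Y
    bound = begin
      r (X ∪ ⁅ x ⁆) + r Y        ≤⟨ +-mono-≤ (mono (∪-least (p⊆p∪q Y+x) (q⊆p∪q X Y+x ∘ q⊆p∪q Y ⁅ x ⁆)))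
                                              (mono (λ y∈Y → x∈p∩q⁺ (Y⊆X y∈Y , p⊆p∪q ⁅ x ⁆ y∈Y))) ⟩
      r (X ∪ Y+x) + r (X ∩ Y+x) ≤⟨ submodular X Y+x ⟩
      r X + r Y+x               ≡⟨ cong (r X +_) Y-spans ⟩
      r X + r Y                 ∎
      where open ≤-Reasoning

  spans-∪ : ∀ X S → (∀ e → e ∈ S → Spans r X e) → r (X ∪ S) ≡ r X
  spans-∪ X = subset-ind (λ S → (∀ e → e ∈ S → Spans r X e) → r (X ∪ S) ≡ r X)
    (λ _ → cong r (∪-identityʳ X)) step
    where
    step : ∀ S x → ((∀ e → e ∈ S → Spans r X e) → r (X ∪ S) ≡ r X) →
           (∀ e → e ∈ S ∪ ⁅ x ⁆ → Spans r X e) → r (X ∪ (S ∪ ⁅ x ⁆)) ≡ r X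
    step S x ih spanned = begin
      r (X ∪ (S ∪ ⁅ x ⁆)) ≡⟨ cong r (∪-assoc X S ⁅ x ⁆) ⟨
      r ((X ∪ S) ∪ ⁅ x ⁆) ≡⟨ spans-mono x (p⊆p∪q S) (spanned x (q⊆p∪q S ⁅ x ⁆ (x∈⁅x⁆ x))) ⟩
      r (X ∪ S)           ≡⟨ ih (λ e e∈S → spanned e (p⊆p∪q ⁅ x ⁆ e∈S)) ⟩
      r X                 ∎
      where open ≡-Reasoning

IsRankFlat : (Subset n → ℕ) → Subset n → Set
IsRankFlat r F = ∀ e → Spans r F e → e ∈ F

IsRankCyclic : (Subset n → ℕ) → Subset n → Set
IsRankCyclic r F = ∀ e → e ∈ F → r (F - e) ≡ r F

IsRankCyclicFlat : (Subset n → ℕ) → Subset n → Set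
IsRankCyclicFlat r F = IsRankFlat r F × IsRankCyclic r F

record IsRankOf (ind : Indep n) (r : Subset n → ℕ) : Set where
  field
    isRankFunction  : IsRankFunction r
    indep⇒r≡card   : ∀ {X} → ind X ≡ true → r X ≡ ∣ X ∣
    r≡card⇒indep   : ∀ {X} → r X ≡ ∣ X ∣ → ind X ≡ true

  open IsRankFunction isRankFunction public

  indep⇒card≤r : ∀ {X Y} → Y ⊆ X → ind Y ≡ true → ∣ Y ∣ ≤ r X
  indep⇒card≤r Y⊆X indY = subst (_≤ _) (indep⇒r≡card indY) (mono Y⊆X)

  dependent⇒r<card : ∀ {X} → ind X ≡ false → r X < ∣ X ∣
  dependent⇒r<card {X} depX =
    ≤∧≢⇒< (≤-card X) λ r≡card → contradiction (trans (sym depX) (r≡card⇒indep r≡card)) λ ()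

  maximal⇒r≡card : ∀ {X Y} → Y ⊆ X → ind Y ≡ true →
                   (∀ e → e ∈ X → e ∉ Y → ind (Y ∪ ⁅ e ⁆) ≢ true) → r X ≡ ∣ Y ∣
  maximal⇒r≡card {X} {Y} Y⊆X indY maximal = ≤-antisym (begin
    r X       ≤⟨ mono (q⊆p∪q Y X) ⟩
    r (Y ∪ X) ≡⟨ spans-∪ Y X spanned ⟩
    r Y       ≡⟨ indep⇒r≡card indY ⟩
    ∣ Y ∣     ∎) (indep⇒card≤r Y⊆X indY)
    where
    open ≤-Reasoning
    spanned : ∀ e → e ∈ X → Spans r Y e
    spanned e e∈X with e ∈? Y | ∪⁅x⁆-dichotomy Y e
    ... | yes e∈Y | _           = cong r (x∈p⇒p∪⁅x⁆≡p e∈Y)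
    ... | no  _   | inj₂ spans  = spans
    ... | no  e∉Y | inj₁ grows  = contradiction (r≡card⇒indep (begin-equality
      r (Y ∪ ⁅ e ⁆)   ≡⟨ grows ⟩
      suc (r Y)       ≡⟨ cong suc (indep⇒r≡card indY) ⟩
      suc ∣ Y ∣       ≡⟨ x∉p⇒∣p∪⁅x⁆∣≡1+∣p∣ e∉Y ⟨
      ∣ Y ∪ ⁅ e ⁆ ∣   ∎)) (maximal e e∈X e∉Y)

  isMatroid : IsMatroid ind
  isMatroid = record
    { empty-indep = r≡card⇒indep (trans r⊥≡0 (sym (∣⊥∣≡0 n)))
    ; down-closed = down-closed
    ; augment     = augment
    }
    where
    down-closed : ∀ {X Y} → X ⊆ Y → ind Y ≡ true → ind X ≡ true
    down-closed {X} {Y} X⊆Y indY =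
      r≡card⇒indep (≤-antisym (≤-card X) (+-cancelʳ-≤ ∣ Y ─ X ∣ _ _ (begin
        ∣ X ∣ + ∣ Y ─ X ∣     ≡⟨ p⊆q⇒∣q∣≡∣p∣+∣q─p∣ X⊆Y ⟨
        ∣ Y ∣                 ≡⟨ indep⇒r≡card indY ⟨
        r Y                   ≤⟨ mono (q⊆p∪q─p X Y) ⟩
        r (X ∪ (Y ─ X))       ≤⟨ subadditive X (Y ─ X) ⟩
        r X + r (Y ─ X)       ≤⟨ +-monoʳ-≤ (r X) (≤-card (Y ─ X)) ⟩
        r X + ∣ Y ─ X ∣       ∎)))
      where open ≤-Reasoning
    augment : ∀ {I J} → ind I ≡ true → ind J ≡ true → ∣ I ∣ < ∣ J ∣ →
              ∃ λ e → e ∈ J × e ∉ I × ind (I ∪ ⁅ e ⁆) ≡ true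
    augment {I} {J} indI indJ ∣I∣<∣J∣
      with any? (λ e → e ∈? J ×-dec ¬? (e ∈? I) ×-dec ind (I ∪ ⁅ e ⁆) Bool.≟ true)
    ... | yes found = found
    ... | no  none  = contradiction (begin
      ∣ J ∣     ≡⟨ indep⇒r≡card indJ ⟨
      r J       ≤⟨ mono (q⊆p∪q I J) ⟩
      r (I ∪ J) ≡⟨ maximal⇒r≡card (p⊆p∪q J) indI maximal ⟩
      ∣ I ∣     ∎) (<⇒≱ ∣I∣<∣J∣)
      where
      open ≤-Reasoning
      maximal : ∀ e → e ∈ I ∪ J → e ∉ I → ind (I ∪ ⁅ e ⁆) ≢ true
      maximal e e∈I∪J e∉I indI+e with x∈p∪q⁻ I J e∈I∪J
      ... | inj₁ e∈I = e∉I e∈I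
      ... | inj₂ e∈J = none (e , e∈J , e∉I , indI+e)

  private
    maximal-of-rank : ∀ X → ∃ λ Y → Y ⊆ X × ind Y ≡ true × ∣ Y ∣ ≡ rank ind X × r X ≡ ∣ Y ∣
    maximal-of-rank X with rank-attained ind (IsMatroid.empty-indep isMatroid) X
    ... | Y , Y⊆X , indY , ∣Y∣≡rank = Y , Y⊆X , indY , ∣Y∣≡rank , maximal⇒r≡card Y⊆X indY maximal
      where
      maximal : ∀ e → e ∈ X → e ∉ Y → ind (Y ∪ ⁅ e ⁆) ≢ true
      maximal e e∈X e∉Y indY+e = 1+n≰n (begin
        suc ∣ Y ∣       ≡⟨ x∉p⇒∣p∪⁅x⁆∣≡1+∣p∣ e∉Y ⟨
        ∣ Y ∪ ⁅ e ⁆ ∣   ≤⟨ rank-upper ind (∪-least Y⊆X (x∈p⇒⁅x⁆⊆p e∈X)) indY+e ⟩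
        rank ind X     ≡⟨ ∣Y∣≡rank ⟨
        ∣ Y ∣           ∎)
        where open ≤-Reasoning

  rank≡r : ∀ X → rank ind X ≡ r X
  rank≡r X = let _ , _ , _ , ∣Y∣≡rank , r≡∣Y∣ = maximal-of-rank X in trans (sym ∣Y∣≡rank) (sym r≡∣Y∣)

  r-attained : ∀ X → ∃ λ Y → Y ⊆ X × ind Y ≡ true × ∣ Y ∣ ≡ r X
  r-attained X = let Y , Y⊆X , indY , _ , r≡∣Y∣ = maximal-of-rank X in Y , Y⊆X , indY , sym r≡∣Y∣

  open Circuits (IsMatroid.down-closed isMatroid) public

  unionOfCircuits⇒rankCyclic : ∀ {F} → IsUnionOfCircuits ind F → IsRankCyclic r F
  unionOfCircuits⇒rankCyclic {F} circuits e e∈F with circuits e e∈F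
  ... | C , isC , e∈C , C⊆F = sym (begin-equality
    r F                 ≡⟨ cong r (x∈p⇒p-x∪⁅x⁆≡p e∈F) ⟨
    r ((F - e) ∪ ⁅ e ⁆) ≡⟨ spans-mono e (p⊆q⇒p-x⊆q-x e C⊆F) C-e-spans ⟩
    r (F - e)           ∎)
    where
    open ≤-Reasoning
    C-minimal : IsMinimalDependent ind C
    C-minimal = isCircuit⇒minimalDependent ind isC
    rC≤r[C-e] : r C ≤ r (C - e)
    rC≤r[C-e] = ≤-pred (begin-strict
      r C              <⟨ dependent⇒r<card (proj₁ C-minimal) ⟩
      ∣ C ∣            ≡⟨ x∈p⇒∣p∣≡1+∣p-x∣ e∈C ⟩
      suc ∣ C - e ∣    ≡⟨ cong suc (indep⇒r≡card (proj₂ C-minimal e e∈C)) ⟨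
      suc (r (C - e))  ∎)
    C-e-spans : Spans r (C - e) e
    C-e-spans = trans (cong r (x∈p⇒p-x∪⁅x⁆≡p e∈C)) (≤-antisym rC≤r[C-e] (mono (p-x⊆p e C)))

  rankCyclic⇒unionOfCircuits : ∀ {F} → IsRankCyclic r F → IsUnionOfCircuits ind F
  rankCyclic⇒unionOfCircuits {F} cyclic e e∈F with r-attained (F - e)
  ... | I , I⊆F-e , indI , ∣I∣≡r[F-e] with dependent⇒∃circuit (¬-not I+e-dependent)
    where
    I+e-dependent : ind (I ∪ ⁅ e ⁆) ≢ true
    I+e-dependent indI+e = 1+n≰n (begin
      suc ∣ I ∣     ≡⟨ x∉p⇒∣p∪⁅x⁆∣≡1+∣p∣ (x∉p-x e F ∘ I⊆F-e) ⟨
      ∣ I ∪ ⁅ e ⁆ ∣ ≤⟨ indep⇒card≤r (∪-least (⊆-trans I⊆F-e (p-x⊆p e F)) (x∈p⇒⁅x⁆⊆p e∈F)) indI+e ⟩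
      r F           ≡⟨ cyclic e e∈F ⟨
      r (F - e)     ≡⟨ ∣I∣≡r[F-e] ⟨
      ∣ I ∣         ∎)
      where open ≤-Reasoning
  ... | C , C⊆I+e , isC =
    C , isC , e∈C , ⊆-trans C⊆I+e (∪-least (⊆-trans I⊆F-e (p-x⊆p e F)) (x∈p⇒⁅x⁆⊆p e∈F))
    where
    e∈C : e ∈ C
    e∈C with e ∈? C
    ... | yes e∈C = e∈C
    ... | no  e∉C = contradiction (IsMatroid.down-closed isMatroid C⊆I indI)
                                  (not-¬ (proj₁ (isCircuit⇒minimalDependent ind isC)))
      where
      C⊆I : C ⊆ I
      C⊆I {y} y∈C with x∈p∪q⁻ I ⁅ e ⁆ (C⊆I+e y∈C)
      ... | inj₁ y∈I  = y∈I
      ... | inj₂ y∈⁅e⁆ rewrite x∈⁅y⁆⇒x≡y e y∈⁅e⁆ = contradiction y∈C e∉C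

  cyclicFlat⇒rankCyclicFlat : ∀ {F} → IsCyclicFlat ind F → IsRankCyclicFlat r F
  cyclicFlat⇒rankCyclicFlat (flat , circuits) =
    (λ e spans → flat e (trans (rank≡r _) (trans spans (sym (rank≡r _))))) ,
    unionOfCircuits⇒rankCyclic circuits

  rankCyclicFlat⇒cyclicFlat : ∀ {F} → IsRankCyclicFlat r F → IsCyclicFlat ind F
  rankCyclicFlat⇒cyclicFlat (flat , cyclic) =
    (λ e spans → flat e (trans (sym (rank≡r _)) (trans spans (rank≡r _)))) ,
    rankCyclic⇒unionOfCircuits cyclic

module _ {ind : Indep n} (M : IsMatroid ind) where
  open IsMatroid M

  indep-extends : ∀ {I X} → I ⊆ X → ind I ≡ true →
                  ∃ λ J → I ⊆ J × J ⊆ X × ind J ≡ true × ∣ J ∣ ≡ rank ind X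
  indep-extends {I} {X} I⊆X indI with rank-attained ind empty-indep X
  ... | K , K⊆X , indK , ∣K∣≡rank = grow (∣ K ∣ ∸ ∣ I ∣) ⊆-refl I⊆X indI
    (m∸n+n≡m (subst (∣ I ∣ ≤_) (sym ∣K∣≡rank) (rank-upper ind I⊆X indI)))
    where
    grow : ∀ {I′} d → I ⊆ I′ → I′ ⊆ X → ind I′ ≡ true → d + ∣ I′ ∣ ≡ ∣ K ∣ →
           ∃ λ J → I ⊆ J × J ⊆ X × ind J ≡ true × ∣ J ∣ ≡ rank ind X
    grow {I′} zero    I⊆I′ I′⊆X indI′ ∣I′∣≡∣K∣ = I′ , I⊆I′ , I′⊆X , indI′ , trans ∣I′∣≡∣K∣ ∣K∣≡rank
    grow {I′} (suc d) I⊆I′ I′⊆X indI′ d+∣I′∣≡∣K∣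
      with augment indI′ indK (subst (∣ I′ ∣ <_) d+∣I′∣≡∣K∣ (s≤s (m≤n+m ∣ I′ ∣ d)))
    ... | e , e∈K , e∉I′ , indI′+e =
      grow d (⊆-trans I⊆I′ (p⊆p∪q ⁅ e ⁆)) (∪-least I′⊆X (x∈p⇒⁅x⁆⊆p (K⊆X e∈K))) indI′+e
        (trans (cong (d +_) (x∉p⇒∣p∪⁅x⁆∣≡1+∣p∣ e∉I′)) (trans (+-suc d ∣ I′ ∣) d+∣I′∣≡∣K∣))

  rank-isRankOf : IsRankOf ind (rank ind)
  rank-isRankOf = record
    { isRankFunction = record { ≤-card = ≤-card ; mono = mono ; submodular = submodular }
    ; indep⇒r≡card  = λ {X} indX → ≤-antisym (≤-card X) (rank-upper ind ⊆-refl indX)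
    ; r≡card⇒indep  = r≡card⇒indep
    }
    where
    r : Subset n → ℕ
    r = rank ind
    ≤-card : ∀ X → r X ≤ ∣ X ∣
    ≤-card X with rank-attained ind empty-indep X
    ... | Y , Y⊆X , _ , ∣Y∣≡r = subst (_≤ ∣ X ∣) ∣Y∣≡r (p⊆q⇒∣p∣≤∣q∣ Y⊆X)
    mono : ∀ {X Y} → X ⊆ Y → r X ≤ r Y
    mono {X} X⊆Y with rank-attained ind empty-indep X
    ... | Z , Z⊆X , indZ , ∣Z∣≡r = subst (_≤ _) ∣Z∣≡r (rank-upper ind (⊆-trans Z⊆X X⊆Y) indZ)
    r≡card⇒indep : ∀ {X} → r X ≡ ∣ X ∣ → ind X ≡ true
    r≡card⇒indep {X} r≡∣X∣ with rank-attained ind empty-indep X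
    ... | Y , Y⊆X , indY , ∣Y∣≡r =
      subst (λ Z → ind Z ≡ true) (p⊆q⇒∣q∣≤∣p∣⇒p≡q Y⊆X (≤-reflexive (trans (sym r≡∣X∣) (sym ∣Y∣≡r)))) indY
    submodular : ∀ X Y → r (X ∪ Y) + r (X ∩ Y) ≤ r X + r Y
    submodular X Y with rank-attained ind empty-indep (X ∩ Y)
    ... | I , I⊆X∩Y , indI , ∣I∣≡r with indep-extends (⊆-trans I⊆X∩Y (⊆-trans (p∩q⊆p X Y) (p⊆p∪q Y))) indI
    ... | J , I⊆J , J⊆X∪Y , indJ , ∣J∣≡r = begin
      r (X ∪ Y) + r (X ∩ Y)
        ≡⟨ cong₂ _+_ ∣J∣≡r ∣I∣≡r ⟨
      ∣ J ∣ + ∣ I ∣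
        ≤⟨ +-mono-≤ (p⊆q⇒∣p∣≤∣q∣ J-split) (p⊆q⇒∣p∣≤∣q∣ I-inside) ⟩
      ∣ (J ∩ X) ∪ (J ∩ Y) ∣ + ∣ (J ∩ X) ∩ (J ∩ Y) ∣
        ≡⟨ ∣p∪q∣+∣p∩q∣≡∣p∣+∣q∣ (J ∩ X) (J ∩ Y) ⟩
      ∣ J ∩ X ∣ + ∣ J ∩ Y ∣
        ≤⟨ +-mono-≤ (J∩-bound X) (J∩-bound Y) ⟩
      r X + r Y ∎
      where
      open ≤-Reasoning
      J∩-bound : ∀ Z → ∣ J ∩ Z ∣ ≤ r Z
      J∩-bound Z = rank-upper ind (p∩q⊆q J Z) (down-closed (p∩q⊆p J Z) indJ)
      J-split : J ⊆ (J ∩ X) ∪ (J ∩ Y)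
      J-split y∈J = x∈p∪q⁺ (Data.Sum.map (λ y∈X → x∈p∩q⁺ (y∈J , y∈X)) (λ y∈Y → x∈p∩q⁺ (y∈J , y∈Y))
                                         (x∈p∪q⁻ X Y (J⊆X∪Y y∈J)))
      I-inside : I ⊆ (J ∩ X) ∩ (J ∩ Y)
      I-inside y∈I = let y∈X , y∈Y = x∈p∩q⁻ X Y (I⊆X∩Y y∈I)
                     in x∈p∩q⁺ (x∈p∩q⁺ (I⊆J y∈I , y∈X) , x∈p∩q⁺ (I⊆J y∈I , y∈Y))

∸-+-mono-≤ : ∀ c {a b x y} → c ≤ a → c ≤ b → a + b ≤ x + y → (a ∸ c) + (b ∸ c) ≤ (x ∸ c) + (y ∸ c)
∸-+-mono-≤ c {a} {b} {x} {y} c≤a c≤b a+b≤x+y = +-cancelˡ-≤ (c + c) _ _ (begin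
  (c + c) + ((a ∸ c) + (b ∸ c)) ≡⟨ interchange c c (a ∸ c) (b ∸ c) ⟩
  (c + (a ∸ c)) + (c + (b ∸ c)) ≡⟨ cong₂ _+_ (m+[n∸m]≡n c≤a) (m+[n∸m]≡n c≤b) ⟩
  a + b                         ≤⟨ a+b≤x+y ⟩
  x + y                         ≤⟨ +-mono-≤ (m≤n+m∸n x c) (m≤n+m∸n y c) ⟩
  (c + (x ∸ c)) + (c + (y ∸ c)) ≡⟨ interchange c c (x ∸ c) (y ∸ c) ⟨
  (c + c) + ((x ∸ c) + (y ∸ c)) ∎)
  where open ≤-Reasoning

dualRank : (Subset n → ℕ) → Subset n → ℕ
dualRank r X = (∣ X ∣ + r (∁ X)) ∸ r ⊤

module _ {ind : Indep n} {r : Subset n → ℕ} (isRank : IsRankOf ind r) where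
  open IsRankOf isRank

  r⊤≤card+r∁ : ∀ X → r ⊤ ≤ ∣ X ∣ + r (∁ X)
  r⊤≤card+r∁ X = begin
    r ⊤               ≡⟨ cong r (p∪∁p≡⊤ X) ⟨
    r (X ∪ ∁ X)       ≤⟨ subadditive X (∁ X) ⟩
    r X + r (∁ X)     ≤⟨ +-monoˡ-≤ (r (∁ X)) (≤-card X) ⟩
    ∣ X ∣ + r (∁ X)   ∎
    where open ≤-Reasoning

  dualRank≡⇒ : ∀ {X Y} → dualRank r X ≡ dualRank r Y → ∣ X ∣ + r (∁ X) ≡ ∣ Y ∣ + r (∁ Y)
  dualRank≡⇒ {X} {Y} eq = begin
    ∣ X ∣ + r (∁ X)           ≡⟨ m∸n+n≡m (r⊤≤card+r∁ X) ⟨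
    dualRank r X + r ⊤        ≡⟨ cong (_+ r ⊤) eq ⟩
    dualRank r Y + r ⊤        ≡⟨ m∸n+n≡m (r⊤≤card+r∁ Y) ⟩
    ∣ Y ∣ + r (∁ Y)           ∎
    where open ≡-Reasoning

  isBasis⇒ : ∀ {B} → isBasis ind B ≡ true → ind B ≡ true × ∣ B ∣ ≡ r ⊤
  isBasis⇒ {B} isB = indB , sym (maximal⇒r≡card ⊆⊤ indB maximal)
    where
    indB : ind B ≡ true
    indB = ∧-conicalˡ _ _ isB
    maximal : ∀ e → e ∈ ⊤ → e ∉ B → ind (B ∪ ⁅ e ⁆) ≢ true
    maximal e _ e∉B indB+e = e∉B (⊆ᵇ⇒⊆ B+e⊆ᵇB (q⊆p∪q B ⁅ e ⁆ (x∈⁅x⁆ e)))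
      where
      B+e⊆ᵇB : (B ∪ ⁅ e ⁆) ⊆ᵇ B ≡ true
      B+e⊆ᵇB = subst₂ (λ a b → not (a ∧ b) ∨ ((B ∪ ⁅ e ⁆) ⊆ᵇ B) ≡ true)
        (⊆⇒⊆ᵇ (p⊆p∪q ⁅ e ⁆)) indB+e (forallS⇒∀ _ (∧-conicalʳ _ _ isB) (B ∪ ⁅ e ⁆))

  ⇒isBasis : ∀ {B} → ind B ≡ true → ∣ B ∣ ≡ r ⊤ → isBasis ind B ≡ true
  ⇒isBasis {B} indB ∣B∣≡r⊤ rewrite indB = ∀⇒forallS _ no-larger
    where
    no-larger : ∀ X → not ((B ⊆ᵇ X) ∧ ind X) ∨ (X ⊆ᵇ B) ≡ true
    no-larger X with B ⊆? X | ind X in indX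
    ... | no  _   | _     = refl
    ... | yes _   | false = refl
    ... | yes B⊆X | true  = ⊆⇒⊆ᵇ (⊆-reflexive (sym (p⊆q⇒∣q∣≤∣p∣⇒p≡q B⊆X
                              (subst (∣ X ∣ ≤_) (sym ∣B∣≡r⊤) (indep⇒card≤r ⊆⊤ indX)))))

  dual⇒r∁≡r⊤ : ∀ {X} → dual ind X ≡ true → r (∁ X) ≡ r ⊤
  dual⇒r∁≡r⊤ {X} dualX with existsS⇒∃ (λ B → isBasis ind B ∧ (X ⊆ᵇ ∁ B)) dualX
  ... | B , B-witness with isBasis⇒ (∧-conicalˡ _ _ B-witness)
  ...   | indB , ∣B∣≡r⊤ = ≤-antisym (mono ⊆⊤) (subst (_≤ r (∁ X)) ∣B∣≡r⊤
                            (indep⇒card≤r (p⊆∁q⇒q⊆∁p (⊆ᵇ⇒⊆ (∧-conicalʳ _ _ B-witness))) indB))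

  r∁≡r⊤⇒dual : ∀ {X} → r (∁ X) ≡ r ⊤ → dual ind X ≡ true
  r∁≡r⊤⇒dual {X} r∁X≡r⊤ with r-attained (∁ X)
  ... | B , B⊆∁X , indB , ∣B∣≡r∁X =
    ∃⇒existsS (λ B → isBasis ind B ∧ (X ⊆ᵇ ∁ B))
      (cong₂ _∧_ (⇒isBasis indB (trans ∣B∣≡r∁X r∁X≡r⊤)) (⊆⇒⊆ᵇ (p⊆∁q⇒q⊆∁p B⊆∁X)))

  dual-isRankOf : IsRankOf (dual ind) (dualRank r)
  dual-isRankOf = record
    { isRankFunction = record { ≤-card = ≤-card* ; mono = mono* ; submodular = submodular* }
    ; indep⇒r≡card  = λ {X} dualX → trans (cong (λ k → (∣ X ∣ + k) ∸ r ⊤) (dual⇒r∁≡r⊤ dualX))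
                                          (m+n∸n≡m ∣ X ∣ (r ⊤))
    ; r≡card⇒indep  = λ {X} r*≡card → r∁≡r⊤⇒dual (+-cancelˡ-≡ ∣ X ∣ _ _
                         (trans (sym (m∸n+n≡m (r⊤≤card+r∁ X))) (cong (_+ r ⊤) r*≡card)))
    }
    where
    open ≤-Reasoning
    ≤-card* : ∀ X → dualRank r X ≤ ∣ X ∣
    ≤-card* X = begin
      (∣ X ∣ + r (∁ X)) ∸ r ⊤ ≤⟨ ∸-monoˡ-≤ (r ⊤) (+-monoʳ-≤ ∣ X ∣ (mono ⊆⊤)) ⟩
      (∣ X ∣ + r ⊤) ∸ r ⊤     ≡⟨ m+n∸n≡m ∣ X ∣ (r ⊤) ⟩
      ∣ X ∣                   ∎
    mono* : ∀ {X Y} → X ⊆ Y → dualRank r X ≤ dualRank r Y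
    mono* {X} {Y} X⊆Y = ∸-monoˡ-≤ (r ⊤) (begin
      ∣ X ∣ + r (∁ X)                    ≤⟨ +-monoʳ-≤ ∣ X ∣ (mono ∁X⊆∁Y∪[Y─X]) ⟩
      ∣ X ∣ + r (∁ Y ∪ (Y ─ X))          ≤⟨ +-monoʳ-≤ ∣ X ∣ (subadditive (∁ Y) (Y ─ X)) ⟩
      ∣ X ∣ + (r (∁ Y) + r (Y ─ X))      ≤⟨ +-monoʳ-≤ ∣ X ∣ (+-monoʳ-≤ (r (∁ Y)) (≤-card (Y ─ X))) ⟩
      ∣ X ∣ + (r (∁ Y) + ∣ Y ─ X ∣)      ≡⟨ cong (∣ X ∣ +_) (+-comm (r (∁ Y)) _) ⟩
      ∣ X ∣ + (∣ Y ─ X ∣ + r (∁ Y))      ≡⟨ +-assoc (∣ X ∣) _ _ ⟨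
      (∣ X ∣ + ∣ Y ─ X ∣) + r (∁ Y)      ≡⟨ cong (_+ r (∁ Y)) (p⊆q⇒∣q∣≡∣p∣+∣q─p∣ X⊆Y) ⟨
      ∣ Y ∣ + r (∁ Y)                    ∎)
      where
      ∁X⊆∁Y∪[Y─X] : ∁ X ⊆ ∁ Y ∪ (Y ─ X)
      ∁X⊆∁Y∪[Y─X] {x} x∈∁X with x ∈? Y
      ... | yes x∈Y = x∈p∪q⁺ (inj₂ (x∈p∧x∉q⇒x∈p─q x∈Y (x∈∁p⇒x∉p x∈∁X)))
      ... | no  x∉Y = x∈p∪q⁺ (inj₁ (x∉p⇒x∈∁p x∉Y))
    submodular* : ∀ X Y → dualRank r (X ∪ Y) + dualRank r (X ∩ Y) ≤ dualRank r X + dualRank r Y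
    submodular* X Y = ∸-+-mono-≤ (r ⊤) (r⊤≤card+r∁ (X ∪ Y)) (r⊤≤card+r∁ (X ∩ Y)) (begin
      (∣ X ∪ Y ∣ + r (∁ (X ∪ Y))) + (∣ X ∩ Y ∣ + r (∁ (X ∩ Y)))
        ≡⟨ interchange (∣ X ∪ Y ∣) _ (∣ X ∩ Y ∣) _ ⟩
      (∣ X ∪ Y ∣ + ∣ X ∩ Y ∣) + (r (∁ (X ∪ Y)) + r (∁ (X ∩ Y)))
        ≡⟨ cong₂ _+_ (∣p∪q∣+∣p∩q∣≡∣p∣+∣q∣ X Y)
                     (cong₂ _+_ (cong r (BooleanAlgebra.deMorgan₂ (∪-∩-booleanAlgebra n) X Y))
                                (cong r (BooleanAlgebra.deMorgan₁ (∪-∩-booleanAlgebra n) X Y))) ⟩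
      (∣ X ∣ + ∣ Y ∣) + (r (∁ X ∩ ∁ Y) + r (∁ X ∪ ∁ Y))
        ≡⟨ cong ((∣ X ∣ + ∣ Y ∣) +_) (+-comm (r (∁ X ∩ ∁ Y)) _) ⟩
      (∣ X ∣ + ∣ Y ∣) + (r (∁ X ∪ ∁ Y) + r (∁ X ∩ ∁ Y))
        ≤⟨ +-monoʳ-≤ (∣ X ∣ + ∣ Y ∣) (submodular (∁ X) (∁ Y)) ⟩
      (∣ X ∣ + ∣ Y ∣) + (r (∁ X) + r (∁ Y))
        ≡⟨ interchange (∣ X ∣) _ _ _ ⟩
      (∣ X ∣ + r (∁ X)) + (∣ Y ∣ + r (∁ Y)) ∎)

  dual-rankCyclicFlat : ∀ {F} → IsRankCyclicFlat (dualRank r) F → IsRankCyclicFlat r (∁ F)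
  dual-rankCyclicFlat {F} (flat* , cyclic*) = flat , cyclic
    where
    open ≡-Reasoning
    cyclic : IsRankCyclic r (∁ F)
    cyclic e e∈∁F with ∪⁅x⁆-dichotomy (∁ F - e) e
    ... | inj₂ spans = trans (sym spans) (cong r (x∈p⇒p-x∪⁅x⁆≡p e∈∁F))
    ... | inj₁ grows = contradiction (flat* e (cong (_∸ r ⊤) (begin
      ∣ F ∪ ⁅ e ⁆ ∣ + r (∁ (F ∪ ⁅ e ⁆)) ≡⟨ cong₂ _+_ (x∉p⇒∣p∪⁅x⁆∣≡1+∣p∣ (x∈∁p⇒x∉p e∈∁F))
                                                       (cong r (∁[p∪⁅x⁆]≡∁p-x F e)) ⟩
      suc ∣ F ∣ + r (∁ F - e)           ≡⟨ +-suc (∣ F ∣) _ ⟨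
      ∣ F ∣ + suc (r (∁ F - e))
        ≡⟨ cong (∣ F ∣ +_) (trans (cong r (sym (x∈p⇒p-x∪⁅x⁆≡p e∈∁F))) grows) ⟨
      ∣ F ∣ + r (∁ F)                   ∎))) (x∈∁p⇒x∉p e∈∁F)
    flat : IsRankFlat r (∁ F)
    flat e spans with e ∈? F
    ... | no  e∉F = x∉p⇒x∈∁p e∉F
    ... | yes e∈F = contradiction (+-cancelʳ-≡ (r (∁ F)) _ _ (begin
      ∣ F - e ∣ + r (∁ F)             ≡⟨ cong (∣ F - e ∣ +_) (trans (cong r (∁[p-x]≡∁p∪⁅x⁆ F e)) spans) ⟨
      ∣ F - e ∣ + r (∁ (F - e))       ≡⟨ dualRank≡⇒ (cyclic* e e∈F) ⟩
      ∣ F ∣ + r (∁ F)                 ≡⟨ cong (_+ r (∁ F)) (x∈p⇒∣p∣≡1+∣p-x∣ e∈F) ⟩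
      suc ∣ F - e ∣ + r (∁ F)         ∎)) (1+n≢n ∘ sym)

⊓-submodular : ∀ c {a b x y} → x ≤ a → y ≤ a → b ≤ x → b ≤ y → a + b ≤ x + y →
               a ⊓ c + b ⊓ c ≤ x ⊓ c + y ⊓ c
⊓-submodular c {a} {b} {x} {y} x≤a y≤a b≤x b≤y a+b≤x+y with a ≤? c
... | yes a≤c rewrite m≤n⇒m⊓n≡m a≤c | m≤n⇒m⊓n≡m (≤-trans x≤a a≤c) | m≤n⇒m⊓n≡m (≤-trans y≤a a≤c)
                    | m≤n⇒m⊓n≡m (≤-trans (≤-trans b≤x x≤a) a≤c) = a+b≤x+y
... | no a≰c rewrite m≥n⇒m⊓n≡n (≰⇒≥ a≰c) with c ≤? x | c ≤? y
...   | yes c≤x | _ rewrite m≥n⇒m⊓n≡n c≤x = +-monoʳ-≤ c (⊓-monoˡ-≤ c b≤y)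
...   | no _ | yes c≤y rewrite m≥n⇒m⊓n≡n c≤y =
  ≤-trans (≤-reflexive (+-comm c (b ⊓ c))) (+-monoˡ-≤ c (⊓-monoˡ-≤ c b≤x))
...   | no c≰x | no c≰y rewrite m≤n⇒m⊓n≡m (≰⇒≥ c≰x) | m≤n⇒m⊓n≡m (≰⇒≥ c≰y) =
  ≤-trans (+-mono-≤ (≰⇒≥ a≰c) (m⊓n≤m b c)) a+b≤x+y

module _ {r : Subset n → ℕ} (isRankFunction : IsRankFunction r) (c : ℕ) where
  open IsRankFunction isRankFunction

  ⊓-isRankFunction : IsRankFunction (λ X → r X ⊓ c)
  ⊓-isRankFunction = record
    { ≤-card     = λ X → ≤-trans (m⊓n≤m (r X) c) (≤-card X)
    ; mono       = λ X⊆Y → ⊓-monoˡ-≤ c (mono X⊆Y)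
    ; submodular = λ X Y → ⊓-submodular c (mono (p⊆p∪q Y)) (mono (q⊆p∪q X Y))
                             (mono (p∩q⊆p X Y)) (mono (p∩q⊆q X Y)) (submodular X Y)
    }

  ⊓-rankCyclicFlat : ∀ {F} → IsRankCyclicFlat (λ X → r X ⊓ c) F → F ≢ ⊤ → IsRankCyclicFlat r F
  ⊓-rankCyclicFlat {F} (flat , cyclic) F≢⊤ with ≤-total (r F) c
  ... | inj₂ c≤rF = contradiction (⊆-antisym ⊆⊤ λ {e} _ → flat e (saturated e)) F≢⊤
    where
    saturated : ∀ e → r (F ∪ ⁅ e ⁆) ⊓ c ≡ r F ⊓ c
    saturated e = trans (m≥n⇒m⊓n≡n (≤-trans c≤rF (mono (p⊆p∪q ⁅ e ⁆)))) (sym (m≥n⇒m⊓n≡n c≤rF))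
  ... | inj₁ rF≤c = (λ e spans → flat e (cong (_⊓ c) spans)) , λ e e∈F → begin
    r (F - e)     ≡⟨ m≤n⇒m⊓n≡m (≤-trans (mono (p-x⊆p e F)) rF≤c) ⟨
    r (F - e) ⊓ c ≡⟨ cyclic e e∈F ⟩
    r F ⊓ c       ≡⟨ m≤n⇒m⊓n≡m rF≤c ⟩
    r F           ∎
    where open ≡-Reasoning

addColoop : (Subset n → ℕ) → Subset (suc n) → ℕ
addColoop r (false ∷ X) = r X
addColoop r (true  ∷ X) = suc (r X)

addColoop-isRankFunction : ∀ {r : Subset n → ℕ} → IsRankFunction r → IsRankFunction (addColoop r)
addColoop-isRankFunction {r = r} isRankFunction = record
  { ≤-card = ≤-card′ ; mono = mono′ ; submodular = submodular′ }
  where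
  open IsRankFunction isRankFunction
  ≤-card′ : ∀ X → addColoop r X ≤ ∣ X ∣
  ≤-card′ (false ∷ X) = ≤-card X
  ≤-card′ (true  ∷ X) = s≤s (≤-card X)
  mono′ : ∀ {X Y} → X ⊆ Y → addColoop r X ≤ addColoop r Y
  mono′ {false ∷ X} {false ∷ Y} X⊆Y = mono (drop-∷-⊆ X⊆Y)
  mono′ {false ∷ X} {true  ∷ Y} X⊆Y = m≤n⇒m≤1+n (mono (drop-∷-⊆ X⊆Y))
  mono′ {true  ∷ X} {false ∷ Y} X⊆Y with () ← X⊆Y here
  mono′ {true  ∷ X} {true  ∷ Y} X⊆Y = s≤s (mono (drop-∷-⊆ X⊆Y))
  submodular′ : ∀ X Y → addColoop r (X ∪ Y) + addColoop r (X ∩ Y) ≤ addColoop r X + addColoop r Y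
  submodular′ (false ∷ X) (false ∷ Y) = submodular X Y
  submodular′ (false ∷ X) (true  ∷ Y) =
    ≤-trans (s≤s (submodular X Y)) (≤-reflexive (sym (+-suc (r X) (r Y))))
  submodular′ (true  ∷ X) (false ∷ Y) = s≤s (submodular X Y)
  submodular′ (true  ∷ X) (true  ∷ Y) =
    s≤s (subst₂ _≤_ (sym (+-suc (r (X ∪ Y)) (r (X ∩ Y)))) (sym (+-suc (r X) (r Y))) (s≤s (submodular X Y)))

addColoop-rankCyclicFlat : ∀ {r : Subset n → ℕ} {F} → IsRankCyclicFlat (addColoop r) F →
                           ∃ λ F′ → IsRankCyclicFlat r F′ × false ∷ F′ ≡ F
addColoop-rankCyclicFlat {r = r} {true ∷ F′} (_ , cyclic) =
  contradiction (trans (cong r (sym (p─⊥≡p F′))) (cyclic zero here)) (1+n≢n ∘ sym)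
addColoop-rankCyclicFlat {r = r} {false ∷ F′} (flat , cyclic) =
  F′ , ((λ e spans → drop-there (flat (suc e) spans)) , λ e e∈F′ → cyclic (suc e) (there e∈F′)) , refl

-- M + e is the truncation to rank r(E) of M with e added as a coloop.
freeExtRank : (Subset n → ℕ) → Subset (suc n) → ℕ
freeExtRank r X = addColoop r X ⊓ r ⊤

module _ {ind : Indep n} {r : Subset n → ℕ} (isRank : IsRankOf ind r) where
  open IsRankOf isRank

  private
    freeExtCircuitIn : Subset (suc n) → Subset (suc n) → Bool
    freeExtCircuitIn I C = (C ⊆ᵇ I) ∧ isCircuitFreeExt ind C

    isCircuit⇒dependent : ∀ {C} → isCircuit ind C ≡ true → ind C ≢ true
    isCircuit⇒dependent isC = not-¬ (proj₁ (isCircuit⇒minimalDependent ind isC))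

  freeExt⇒noCircuit : ∀ {I C} → freeExt ind I ≡ true → C ⊆ I → isCircuitFreeExt ind C ≢ true
  freeExt⇒noCircuit {I} {C} feI C⊆I isC =
    contradiction (trans (sym (∃⇒existsS (freeExtCircuitIn I) {C} (cong₂ _∧_ (⊆⇒⊆ᵇ C⊆I) isC)))
                         (not-injective feI)) λ ()

  noCircuit⇒freeExt : ∀ {I} → (∀ C → C ⊆ I → isCircuitFreeExt ind C ≢ true) → freeExt ind I ≡ true
  noCircuit⇒freeExt {I} noCircuit with existsS (freeExtCircuitIn I) in found
  ... | false = refl
  ... | true with existsS⇒∃ (freeExtCircuitIn I) found
  ...   | C , C-found = contradiction (∧-conicalʳ _ _ C-found) (noCircuit C (⊆ᵇ⇒⊆ (∧-conicalˡ _ _ C-found)))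

  freeExt⇒indep : ∀ {b J} → freeExt ind (b ∷ J) ≡ true → ind J ≡ true
  freeExt⇒indep feJ = ¬-not λ depJ →
    let C , C⊆J , isC = dependent⇒∃circuit depJ in freeExt⇒noCircuit feJ (out⊆ C⊆J) isC

  freeExt⇒card< : ∀ {J} → freeExt ind (true ∷ J) ≡ true → ∣ J ∣ < r ⊤
  freeExt⇒card< {J} feJ with ∣ J ∣ <? r ⊤
  ... | yes ∣J∣<r⊤ = ∣J∣<r⊤
  ... | no  ∣J∣≮r⊤ = contradiction (⇒isBasis isRank indJ (≤-antisym (indep⇒card≤r ⊆⊤ indJ) (≮⇒≥ ∣J∣≮r⊤)))
                                   (freeExt⇒noCircuit feJ ⊆-refl)
    where
    indJ : ind J ≡ true
    indJ = freeExt⇒indep feJ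

  indep⇒freeExt : ∀ {J} → ind J ≡ true → freeExt ind (false ∷ J) ≡ true
  indep⇒freeExt indJ = noCircuit⇒freeExt λ
    { (false ∷ C) C⊆J isC → isCircuit⇒dependent isC (down-closed (drop-∷-⊆ C⊆J) indJ)
    ; (true  ∷ C) C⊆J _   → case C⊆J here of λ () }
    where open IsMatroid isMatroid

  indep∧card<⇒freeExt : ∀ {J} → ind J ≡ true → ∣ J ∣ < r ⊤ → freeExt ind (true ∷ J) ≡ true
  indep∧card<⇒freeExt {J} indJ ∣J∣<r⊤ = noCircuit⇒freeExt λ
    { (false ∷ C) C⊆J isC → isCircuit⇒dependent isC (down-closed (drop-∷-⊆ C⊆J) indJ)
    ; (true  ∷ B) B⊆J isB → <⇒≱ ∣J∣<r⊤ (subst (_≤ ∣ J ∣) (proj₂ (isBasis⇒ isRank isB))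
                                               (p⊆q⇒∣p∣≤∣q∣ (drop-∷-⊆ B⊆J))) }
    where open IsMatroid isMatroid

  freeExt-isRankOf : IsRankOf (freeExt ind) (freeExtRank r)
  freeExt-isRankOf = record
    { isRankFunction = ⊓-isRankFunction (addColoop-isRankFunction isRankFunction) (r ⊤)
    ; indep⇒r≡card  = indep⇒r≡card⁺
    ; r≡card⇒indep  = r≡card⇒indep⁺
    }
    where
    indep⇒r≡card⁺ : ∀ {X} → freeExt ind X ≡ true → freeExtRank r X ≡ ∣ X ∣
    indep⇒r≡card⁺ {false ∷ J} feJ = trans (m≤n⇒m⊓n≡m (mono ⊆⊤)) (indep⇒r≡card (freeExt⇒indep feJ))
    indep⇒r≡card⁺ {true  ∷ J} feJ =
      trans (cong (λ k → suc k ⊓ r ⊤) (indep⇒r≡card (freeExt⇒indep feJ))) (m≤n⇒m⊓n≡m (freeExt⇒card< feJ))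
    r≡card⇒indep⁺ : ∀ {X} → freeExtRank r X ≡ ∣ X ∣ → freeExt ind X ≡ true
    r≡card⇒indep⁺ {false ∷ J} r⁺≡card =
      indep⇒freeExt (r≡card⇒indep (trans (sym (m≤n⇒m⊓n≡m (mono ⊆⊤))) r⁺≡card))
    r≡card⇒indep⁺ {true  ∷ J} r⁺≡card = indep∧card<⇒freeExt
      (r≡card⇒indep (≤-antisym (≤-card J) (≤-pred (subst (_≤ suc (r J)) r⁺≡card (m⊓n≤m _ _)))))
      (subst (_≤ r ⊤) r⁺≡card (m⊓n≤n _ _))

  freeExt-rankCyclicFlat : ∀ {F} → IsRankCyclicFlat (freeExtRank r) F → F ≢ ⊤ →
                           ∃ λ F′ → IsRankCyclicFlat r F′ × false ∷ F′ ≡ F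
  freeExt-rankCyclicFlat cyclicFlat F≢⊤ = addColoop-rankCyclicFlat
    (⊓-rankCyclicFlat (addColoop-isRankFunction isRankFunction) (r ⊤) cyclicFlat F≢⊤)

-- When r ⊤ = 0 the truncated subtraction gives 0, and indeed T(M) = M then.
truncationRank : (Subset n → ℕ) → Subset n → ℕ
truncationRank r X = r X ⊓ (r ⊤ ∸ 1)

[1+m]⊓n∸1⊓n≡m⊓[n∸1] : ∀ m n → (suc m ⊓ n) ∸ (1 ⊓ n) ≡ m ⊓ (n ∸ 1)
[1+m]⊓n∸1⊓n≡m⊓[n∸1] m zero    = sym (⊓-zeroʳ m)
[1+m]⊓n∸1⊓n≡m⊓[n∸1] m (suc n) = refl

module _ {ind : Indep n} {r : Subset n → ℕ} (isRank : IsRankOf ind r) where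
  open IsRankOf isRank

  contract0-freeExt-rank : ∀ I →
    rank (freeExt ind) (true ∷ I) ∸ rank (freeExt ind) (true ∷ ⊥) ≡ truncationRank r I
  contract0-freeExt-rank I = begin
    rank (freeExt ind) (true ∷ I) ∸ rank (freeExt ind) (true ∷ ⊥)
      ≡⟨ cong₂ _∸_ (IsRankOf.rank≡r isRank⁺ (true ∷ I)) (IsRankOf.rank≡r isRank⁺ (true ∷ ⊥)) ⟩
    (suc (r I) ⊓ r ⊤) ∸ (suc (r ⊥) ⊓ r ⊤)
      ≡⟨ cong (λ k → (suc (r I) ⊓ r ⊤) ∸ (suc k ⊓ r ⊤)) r⊥≡0 ⟩
    (suc (r I) ⊓ r ⊤) ∸ (1 ⊓ r ⊤)
      ≡⟨ [1+m]⊓n∸1⊓n≡m⊓[n∸1] (r I) (r ⊤) ⟩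
    r I ⊓ (r ⊤ ∸ 1) ∎
    where
    open ≡-Reasoning
    isRank⁺ : IsRankOf (freeExt ind) (freeExtRank r)
    isRank⁺ = freeExt-isRankOf isRank

  truncation-isRankOf : IsRankOf (truncation ind) (truncationRank r)
  truncation-isRankOf = record
    { isRankFunction = ⊓-isRankFunction isRankFunction (r ⊤ ∸ 1)
    ; indep⇒r≡card  = λ {I} truncI →
        trans (sym (contract0-freeExt-rank I)) (≡ᵇ⇒≡ _ _ (Equivalence.from T-≡ truncI))
    ; r≡card⇒indep  = λ {I} rᵀ≡card →
        Equivalence.to T-≡ (≡⇒≡ᵇ _ _ (trans (contract0-freeExt-rank I) rᵀ≡card))
    }

  truncation-rankCyclicFlat : ∀ {F} → IsRankCyclicFlat (truncationRank r) F → F ≢ ⊤ → IsRankCyclicFlat r F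
  truncation-rankCyclicFlat = ⊓-rankCyclicFlat isRankFunction (r ⊤ ∸ 1)

AntichainBound : ℕ → (Subset n → Set) → Set
AntichainBound {n} k P = ∀ (A : List (Subset n)) → All P A → AllPairs Incomparable A → length A ≤ k

antichainBound-pullback : ∀ {m k} {P : Subset n → Set} {Q : Subset m → Set} (g : Subset m → Subset n) →
                          (∀ {X Y} → Incomparable (g X) (g Y) → Incomparable X Y) →
                          (∀ {F} → P F → ∃ λ F′ → Q F′ × g F′ ≡ F) →
                          AntichainBound k Q → AntichainBound k P
antichainBound-pullback {k = k} {P} {Q} g reflects preimage bound A PA antichain with preimages PA
  where
  preimages : ∀ {A} → All P A → ∃ λ A′ → All Q A′ × map g A′ ≡ A
  preimages []         = [] , [] , refl
  preimages (PF ∷ PA) with preimage PF | preimages PA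
  ... | F′ , QF′ , refl | A′ , QA′ , refl = F′ ∷ A′ , QF′ ∷ QA′ , refl
... | A′ , QA′ , refl =
  subst (_≤ k) (sym (length-map g A′)) (bound A′ QA′ (AllPairs.map reflects (AllPairs.map⁻ antichain)))

antichain∋⊤⇒length≤1 : ∀ {A : List (Subset n)} → ⊤ ∈ₗ A → AllPairs Incomparable A → length A ≤ 1
antichain∋⊤⇒length≤1 {A = _ ∷ []}    _           _                 = ≤-refl
antichain∋⊤⇒length≤1 {A = _ ∷ _ ∷ _} (here refl) ((⊤⋈G ∷ _) ∷ _)   = ⊥-elim (proj₂ ⊤⋈G ⊆⊤)
antichain∋⊤⇒length≤1 {A = _ ∷ _ ∷ _} (there ⊤∈A) (F⋈A ∷ _)        = ⊥-elim (proj₁ (All.lookup F⋈A ⊤∈A) ⊆⊤)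

antichainBound-⊤ : ∀ {k} {P : Subset n → Set} → 1 ≤ k →
                   AntichainBound k (λ F → P F × F ≢ ⊤) → AntichainBound k P
antichainBound-⊤ 1≤k bound A PA antichain with Any.any? (≡-dec Bool._≟_ ⊤) A
... | yes ⊤∈A = ≤-trans (antichain∋⊤⇒length≤1 ⊤∈A antichain) 1≤k
... | no  ⊤∉A = bound A (All.zip (PA , All.map (_∘ sym) (¬Any⇒All¬ A ⊤∉A))) antichain

module _ {k : ℕ} {ind : Indep n} (inCW : InCW k ind) where
  private
    isRank : IsRankOf ind (rank ind)
    isRank = rank-isRankOf (proj₁ inCW)
    width : CyclicWidth≤ k ind
    width = proj₂ inCW
    open IsRankOf isRank using (rankCyclicFlat⇒cyclicFlat)

  dual-inCW : InCW k (dual ind)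
  dual-inCW = IsRankOf.isMatroid isRank* , antichainBound-pullback ∁ ∁-reflects preimage width
    where
    isRank* : IsRankOf (dual ind) (dualRank (rank ind))
    isRank* = dual-isRankOf isRank
    ∁-reflects : ∀ {X Y} → Incomparable (∁ X) (∁ Y) → Incomparable X Y
    ∁-reflects (∁X⊈∁Y , ∁Y⊈∁X) = ∁Y⊈∁X ∘ p⊆q⇒∁p⊇∁q , ∁X⊈∁Y ∘ p⊆q⇒∁p⊇∁q
    preimage : ∀ {F} → IsCyclicFlat (dual ind) F → ∃ λ F′ → IsCyclicFlat ind F′ × ∁ F′ ≡ F
    preimage {F} cyclicFlat = ∁ F ,
      rankCyclicFlat⇒cyclicFlat
        (dual-rankCyclicFlat isRank (IsRankOf.cyclicFlat⇒rankCyclicFlat isRank* cyclicFlat)) ,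
      ∁-involutive F

  freeExt-inCW : 1 ≤ k → InCW k (freeExt ind)
  freeExt-inCW 1≤k = IsRankOf.isMatroid isRank⁺ ,
    antichainBound-⊤ 1≤k (antichainBound-pullback (false ∷_) ∷-reflects preimage width)
    where
    isRank⁺ : IsRankOf (freeExt ind) (freeExtRank (rank ind))
    isRank⁺ = freeExt-isRankOf isRank
    ∷-reflects : ∀ {X Y} → Incomparable (false ∷ X) (false ∷ Y) → Incomparable X Y
    ∷-reflects (X⊈Y , Y⊈X) = X⊈Y ∘ out⊆ , Y⊈X ∘ out⊆
    preimage : ∀ {F} → IsCyclicFlat (freeExt ind) F × F ≢ ⊤ → ∃ λ F′ → IsCyclicFlat ind F′ × false ∷ F′ ≡ F
    preimage (cyclicFlat , F≢⊤) =
      let F′ , rankCyclicFlat , F′≡F = freeExt-rankCyclicFlat isRank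
                                         (IsRankOf.cyclicFlat⇒rankCyclicFlat isRank⁺ cyclicFlat) F≢⊤
      in F′ , rankCyclicFlat⇒cyclicFlat rankCyclicFlat , F′≡F

  truncation-inCW : 1 ≤ k → InCW k (truncation ind)
  truncation-inCW 1≤k = IsRankOf.isMatroid isRankᵀ ,
    antichainBound-⊤ 1≤k (antichainBound-pullback (λ F → F) (λ incomparable → incomparable) preimage width)
    where
    isRankᵀ : IsRankOf (truncation ind) (truncationRank (rank ind))
    isRankᵀ = truncation-isRankOf isRank
    preimage : ∀ {F} → IsCyclicFlat (truncation ind) F × F ≢ ⊤ → ∃ λ F′ → IsCyclicFlat ind F′ × F′ ≡ F
    preimage {F} (cyclicFlat , F≢⊤) = F , rankCyclicFlat⇒cyclicFlat
      (truncation-rankCyclicFlat isRank (IsRankOf.cyclicFlat⇒rankCyclicFlat isRankᵀ cyclicFlat) F≢⊤) , refl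

corollary5p2 : (k : ℕ) → 1 ≤ k → (n : ℕ) → (ind : Indep n) →
    InCW k ind →
    InCW k (freeExt ind) × InCW k (freeCoext ind) ×
    InCW k (truncation ind) × InCW k (higgsLift ind)
corollary5p2 k 1≤k n ind inCW =
  freeExt-inCW inCW 1≤k ,
  dual-inCW (freeExt-inCW (dual-inCW inCW) 1≤k) ,
  truncation-inCW inCW 1≤k ,
  dual-inCW (truncation-inCW (dual-inCW inCW) 1≤k)
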